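{- Let $\mathcal B$ be a pre-matroid on a finite set $X$ and let $\omega,\pi,a,z,\varepsilon$ be as in the context. If $B\in\mathcal B$ is $\omega$-balanced, then $\varepsilon$ induces a bijection $\varphi_\omega^{ -1}(B)\to\varphi_\pi^{ -1}(\varepsilon(B))$.
   Context: A pre-matroid on a finite set $X$ is a non-empty set $\mathcal B$ of subsets of $X$ (bases). For $Y\subseteq X$, $x\notin Y$, $Y+x=Y\cup\{x\}$; for $y\in Y$, $Y-y=Y\setminus\{y\}$. An almost-basis is $B-x$ with $B\in\mathcal B$, $x\in B$; $U(D)=\{x\notin D: D+x\in\mathcal B\}$. For a linear order $\rho$ on $X$ and an almost-basis $D$, $\varphi_\rho(D)=D+\min_\rho U(D)$, a map from almost-bases to bases. Let $\omega$ be a linear order on $X$, $a\ne z$ consecutive for $\omega$ with $a<_\omega z$, $\varepsilon$ the transposition exchanging $a,z$ (acting on subsets elementwise), and $\pi$ the linear order agreeing with $\omega$ except $z<_\pi a$. An almost-basis $Q$ is balanced if $\varepsilon(Q)$ is an almost-basis, $\varepsilon(\varphi_\omega(Q))=\varphi_\pi(\varepsilon(Q))$ and $\varepsilon(\varphi_\pi(Q))=\varphi_\omega(\varepsilon(Q))$. A basis $B$ is $\omega$-balanced if $\varepsilon(B)\in\mathcal B$ and every almost-basis $Q$ with $\varphi_\omega(Q)=B$ or $\varphi_\pi(Q)=\varepsilon(B)$ is balanced. -}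

module Defs where

open import Data.Nat using (ℕ; suc)
open import Data.Bool using (Bool; true; false)
open import Data.Fin using (Fin; toℕ; _≟_)
open import Data.Fin.Subset using (Subset; _∈_; _∉_; inside; outside)
open import Data.Fin.Permutation using (Permutation′; _⟨$⟩ʳ_)
open import Data.Vec using (Vec; tabulate; lookup; _[_]≔_)
open import Data.Product using (Σ; ∃; _×_; _,_)
open import Data.Sum using (_⊎_)
open import Relation.Nullary using (¬_; yes; no)
open import Relation.Binary.PropositionalEquality using (_≡_)
import Data.Nat as N

Family : ℕ → Set
Family n = Subset n → Bool

_∈𝓑_ : ∀ {n} → Subset n → Family n → Set
B ∈𝓑 𝓑 = 𝓑 B ≡ true

IsPreMatroid : ∀ {n} → Family n → Set
IsPreMatroid {n} 𝓑 = Σ (Subset n) λ B → B ∈𝓑 𝓑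

_+ₛ_ : ∀ {n} → Subset n → Fin n → Subset n
Y +ₛ x = Y [ x ]≔ inside

_-ₛ_ : ∀ {n} → Subset n → Fin n → Subset n
Y -ₛ y = Y [ y ]≔ outside

-- A linear order ρ on Fin n, encoded by its rank bijection: x <ρ y iff rank x < rank y.
LinOrder : ℕ → Set
LinOrder = Permutation′

rank : ∀ {n} → LinOrder n → Fin n → ℕ
rank ρ x = toℕ (ρ ⟨$⟩ʳ x)

IsAlmostBasis : ∀ {n} → Family n → Subset n → Set
IsAlmostBasis {n} 𝓑 D = Σ (Subset n) λ B → Σ (Fin n) λ x →
  B ∈𝓑 𝓑 × x ∈ B × D ≡ B -ₛ x

InU : ∀ {n} → Family n → Subset n → Fin n → Set
InU 𝓑 D x = x ∉ D × (D +ₛ x) ∈𝓑 𝓑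

IsMinU : ∀ {n} → Family n → LinOrder n → Subset n → Fin n → Set
IsMinU 𝓑 ρ D m = InU 𝓑 D m × (∀ y → InU 𝓑 D y → rank ρ m N.≤ rank ρ y)

-- φ_ρ(D) = B  (graph of the map φ_ρ from almost-bases to bases)
Phi : ∀ {n} → Family n → LinOrder n → Subset n → Subset n → Set
Phi 𝓑 ρ D B = ∃ λ m → IsMinU 𝓑 ρ D m × B ≡ D +ₛ m

swapFin : ∀ {n} → Fin n → Fin n → Fin n → Fin n
swapFin a z x with x ≟ a
... | yes _ = z
... | no _ with x ≟ z
...   | yes _ = a
...   | no _ = x

εS : ∀ {n} → Fin n → Fin n → Subset n → Subset n
εS a z S = tabulate λ x → lookup S (swapFin a z x)

IsSwapSetup : ∀ {n} → LinOrder n → LinOrder n → Fin n → Fin n → Set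
IsSwapSetup ω π a z =
  ¬ (a ≡ z) ×
  rank ω z ≡ suc (rank ω a) ×
  rank π a ≡ rank ω z × rank π z ≡ rank ω a ×
  (∀ x → ¬ (x ≡ a) → ¬ (x ≡ z) → rank π x ≡ rank ω x)

IsBalanced : ∀ {n} → Family n → LinOrder n → LinOrder n → Fin n → Fin n → Subset n → Set
IsBalanced 𝓑 ω π a z Q =
  IsAlmostBasis 𝓑 (εS a z Q) ×
  (∀ B' → Phi 𝓑 ω Q B' → Phi 𝓑 π (εS a z Q) (εS a z B')) ×
  (∀ B' → Phi 𝓑 π Q B' → Phi 𝓑 ω (εS a z Q) (εS a z B'))

IsωBalanced : ∀ {n} → Family n → LinOrder n → LinOrder n → Fin n → Fin n → Subset n → Set
IsωBalanced 𝓑 ω π a z B =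
  εS a z B ∈𝓑 𝓑 ×
  (∀ Q → IsAlmostBasis 𝓑 Q → Phi 𝓑 ω Q B ⊎ Phi 𝓑 π Q (εS a z B) → IsBalanced 𝓑 ω π a z Q)

-- ε is an involution of X, hence acts injectively on subsets.  Balancedness of
-- each Q with φ_ω(Q) = B says that ε(Q) lies in the π-fibre of ε(B); balancedness
-- of each Q′ with φ_π(Q′) = ε(B) says that ε(Q′) lies in the ω-fibre of ε(ε(B)) = B,
-- and ε(ε(Q′)) = Q′ makes it a preimage.
module Submission where

open import Defs
open import Data.Fin using (Fin; _≟_)
open import Data.Fin.Subset using (Subset; _∉_; inside; outside)
open import Data.Product using (Σ; _×_; _,_; proj₁; proj₂)
open import Data.Sum using (inj₁; inj₂)
open import Data.Vec using (lookup; tabulate; _[_]≔_)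
open import Data.Vec.Properties
  using ([]≔-idempotent; []≔-lookup; []≔-updates; lookup⇒[]=; lookup∘tabulate; tabulate∘lookup; tabulate-cong)
open import Function using (_∘_)
open import Relation.Nullary using (contradiction; yes; no)
open import Relation.Binary.PropositionalEquality
open ≡-Reasoning

∉⇒lookup≡outside : ∀ {n} (Q : Subset n) x → x ∉ Q → lookup Q x ≡ outside
∉⇒lookup≡outside Q x x∉Q with lookup Q x in eq
... | outside = refl
... | inside  = contradiction (lookup⇒[]= x Q eq) x∉Q

+ₛ-−ₛ-cancel : ∀ {n} (Q : Subset n) x → x ∉ Q → (Q +ₛ x) -ₛ x ≡ Q
+ₛ-−ₛ-cancel Q x x∉Q = begin
  (Q [ x ]≔ inside) [ x ]≔ outside  ≡⟨ []≔-idempotent Q x ⟩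
  Q [ x ]≔ outside                  ≡⟨ cong (Q [ x ]≔_) (∉⇒lookup≡outside Q x x∉Q) ⟨
  Q [ x ]≔ lookup Q x               ≡⟨ []≔-lookup Q x ⟩
  Q                                 ∎

Phi⇒IsAlmostBasis : ∀ {n} (𝓑 : Family n) ρ Q B → Phi 𝓑 ρ Q B → IsAlmostBasis 𝓑 Q
Phi⇒IsAlmostBasis _ _ Q _ (m , ((m∉Q , Q+m∈𝓑) , _) , _) =
  Q +ₛ m , m , Q+m∈𝓑 , []≔-updates Q m , sym (+ₛ-−ₛ-cancel Q m m∉Q)

swapFin-involutive : ∀ {n} (a z : Fin n) x → swapFin a z (swapFin a z x) ≡ x
swapFin-involutive a z x with x ≟ a
... | yes refl with z ≟ x
...   | yes z≡x = z≡x
...   | no _ rewrite ≡-≟-identity _≟_ {z} refl = refl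
swapFin-involutive a z x | no x≢a with x ≟ z
... | yes refl rewrite ≡-≟-identity _≟_ {a} refl = refl
... | no x≢z rewrite ≢-≟-identity _≟_ x≢a | ≢-≟-identity _≟_ x≢z = refl

εS-involutive : ∀ {n} (a z : Fin n) S → εS a z (εS a z S) ≡ S
εS-involutive a z S = begin
  tabulate (λ x → lookup (εS a z S) (swapFin a z x))
    ≡⟨ tabulate-cong (λ x → lookup∘tabulate (lookup S ∘ swapFin a z) (swapFin a z x)) ⟩
  tabulate (λ x → lookup S (swapFin a z (swapFin a z x)))
    ≡⟨ tabulate-cong (cong (lookup S) ∘ swapFin-involutive a z) ⟩
  tabulate (lookup S)
    ≡⟨ tabulate∘lookup S ⟩
  S ∎

εS-injective : ∀ {n} (a z : Fin n) {S T} → εS a z S ≡ εS a z T → S ≡ T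
εS-injective a z {S} {T} εS≡εT = begin
  S                     ≡⟨ εS-involutive a z S ⟨
  εS a z (εS a z S)     ≡⟨ cong (εS a z) εS≡εT ⟩
  εS a z (εS a z T)     ≡⟨ εS-involutive a z T ⟩
  T                     ∎

lemma8p4 : ∀ {n} (𝓑 : Family n) → IsPreMatroid 𝓑 →
    (ω π : LinOrder n) (a z : Fin n) → IsSwapSetup ω π a z →
    (B : Subset n) → B ∈𝓑 𝓑 → IsωBalanced 𝓑 ω π a z B →
    (∀ Q → Phi 𝓑 ω Q B → Phi 𝓑 π (εS a z Q) (εS a z B)) ×
    (∀ Q₁ Q₂ → Phi 𝓑 ω Q₁ B → Phi 𝓑 ω Q₂ B → εS a z Q₁ ≡ εS a z Q₂ → Q₁ ≡ Q₂) ×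
    (∀ Q′ → Phi 𝓑 π Q′ (εS a z B) → Σ (Subset n) λ Q → Phi 𝓑 ω Q B × εS a z Q ≡ Q′)
lemma8p4 {n} 𝓑 _ ω π a z _ B _ (_ , fibre-balanced) =
  maps-to , (λ _ _ _ _ → εS-injective a z) , onto
  where
  maps-to : ∀ Q → Phi 𝓑 ω Q B → Phi 𝓑 π (εS a z Q) (εS a z B)
  maps-to Q φωQ =
    proj₁ (proj₂ (fibre-balanced Q (Phi⇒IsAlmostBasis 𝓑 ω Q B φωQ) (inj₁ φωQ))) B φωQ

  onto : ∀ Q′ → Phi 𝓑 π Q′ (εS a z B) → Σ (Subset n) λ Q → Phi 𝓑 ω Q B × εS a z Q ≡ Q′
  onto Q′ φπQ′ = εS a z Q′ , φωεQ′ , εS-involutive a z Q′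
    where
    φωεQ′ : Phi 𝓑 ω (εS a z Q′) B
    φωεQ′ = subst (Phi 𝓑 ω (εS a z Q′)) (εS-involutive a z B)
      (proj₂ (proj₂ (fibre-balanced Q′ (Phi⇒IsAlmostBasis 𝓑 π Q′ (εS a z B) φπQ′) (inj₂ φπQ′))) (εS a z B) φπQ′)
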